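{- Let $F$ be any finite simple graph that has a perfect matching. Let $G$ be obtained from $F$ by attaching to every vertex $v$ of $F$ two new paths of length two (each such path has $v$ as one endpoint and two new vertices, all new vertices distinct). Then $\nu(G)=\frac{5|V(F)|}{2}$, $\lambda_2(G)=4|V(F)|$, $\alpha_2(G)=2|V(F)|$, and hence $\frac{\nu(G)}{\alpha_2(G)}=\frac{5}{4}$. In particular there are infinitely many graphs attaining the bound $5/4$.
   Context: $\nu(G)$ is the size of a maximum matching of $G$. $B_2(G)$ is the set of ordered pairs $(H,H')$ of edge-disjoint matchings of $G$; $\lambda_2(G)=\max\{|H|+|H'| : (H,H')\in B_2(G)\}$; $\alpha_2(G)=\max\{|H|,|H'| : (H,H')\in B_2(G),\ |H|+|H'|=\lambda_2(G)\}$. -}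

module Defs where

open import Data.Nat using (ℕ; _≤_; _+_; _*_; _⊔_)
open import Data.Fin using (Fin)
open import Data.Bool using (Bool; true; false)
open import Data.Sum using (_⊎_; inj₁; inj₂)
open import Data.Product using (_×_; _,_; Σ; ∃; ∃-syntax)
open import Data.List using (List; []; _∷_; length; concatMap)
open import Data.List.Relation.Unary.All using (All)
open import Data.List.Relation.Unary.Unique.Propositional using (Unique)
open import Data.List.Membership.Propositional using (_∈_)
open import Data.Empty using (⊥)
open import Data.Unit using (⊤)
open import Relation.Nullary using (¬_)
open import Relation.Binary.PropositionalEquality using (_≡_; _≢_)

record Graph : Set₁ where
  field
    V      : Set
    Adj    : V → V → Set
    sym    : ∀ {u v} → Adj u v → Adj v u
    irrefl : ∀ {v} → ¬ Adj v v
open Graph public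

record FinGraph (n : ℕ) : Set₁ where
  field
    Adj    : Fin n → Fin n → Set
    sym    : ∀ {u v} → Adj u v → Adj v u
    irrefl : ∀ {v} → ¬ Adj v v

toGraph : ∀ {n} → FinGraph n → Graph
toGraph {n} F = record
  { V = Fin n ; Adj = FinGraph.Adj F ; sym = FinGraph.sym F ; irrefl = FinGraph.irrefl F }

module _ (G : Graph) where

  -- an edge set given as a list of (oriented) edges
  endpoints : List (V G × V G) → List (V G)
  endpoints = concatMap (λ { (u , v) → u ∷ v ∷ [] })

  -- a matching: every listed pair is an edge, and all endpoints are pairwise
  -- distinct (so edges are distinct and pairwise vertex-disjoint); |M| = length M
  IsMatching : List (V G × V G) → Set
  IsMatching M = All (λ { (u , v) → Adj G u v }) M × Unique (endpoints M)

  IsPerfectMatching : List (V G × V G) → Set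
  IsPerfectMatching M = IsMatching M × (∀ v → v ∈ endpoints M)

  HasPerfectMatching : Set
  HasPerfectMatching = ∃[ M ] IsPerfectMatching M

  IsNu : ℕ → Set
  IsNu k = (∃[ M ] (IsMatching M × length M ≡ k))
         × (∀ M → IsMatching M → length M ≤ k)

  SameEdge : V G × V G → V G × V G → Set
  SameEdge (u , v) (u' , v') = (u ≡ u' × v ≡ v') ⊎ (u ≡ v' × v ≡ u')

  EdgeDisjoint : List (V G × V G) → List (V G × V G) → Set
  EdgeDisjoint H H' = ∀ {e e'} → e ∈ H → e' ∈ H' → ¬ SameEdge e e'

  InB2 : List (V G × V G) → List (V G × V G) → Set
  InB2 H H' = IsMatching H × IsMatching H' × EdgeDisjoint H H'

  IsLambda2 : ℕ → Set
  IsLambda2 l = (∃[ H ] ∃[ H' ] (InB2 H H' × length H + length H' ≡ l))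
              × (∀ H H' → InB2 H H' → length H + length H' ≤ l)

  IsAlpha2 : ℕ → Set
  IsAlpha2 a = Σ ℕ λ l → IsLambda2 l
    × (∃[ H ] ∃[ H' ] (InB2 H H' × length H + length H' ≡ l × length H ⊔ length H' ≡ a))
    × (∀ H H' → InB2 H H' → length H + length H' ≡ l → length H ⊔ length H' ≤ a)

-- vertices of the attached paths: (v , i , b) is the i-th path at v;
-- b = false is the middle vertex (adjacent to v), b = true the far endpoint.
data AttAdj {n : ℕ} : Fin n ⊎ (Fin n × Fin 2 × Bool) → Fin n ⊎ (Fin n × Fin 2 × Bool) → Set where
  root-mid : ∀ v i → AttAdj (inj₁ v) (inj₂ (v , i , false))
  mid-root : ∀ v i → AttAdj (inj₂ (v , i , false)) (inj₁ v)
  mid-end  : ∀ v i → AttAdj (inj₂ (v , i , false)) (inj₂ (v , i , true))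
  end-mid  : ∀ v i → AttAdj (inj₂ (v , i , true)) (inj₂ (v , i , false))

AdjG : ∀ {n} → FinGraph n → Fin n ⊎ (Fin n × Fin 2 × Bool) → Fin n ⊎ (Fin n × Fin 2 × Bool) → Set
AdjG F (inj₁ u) (inj₁ w) = FinGraph.Adj F u w
AdjG F x y = AttAdj x y

private
  attSym : ∀ {n} {x y : Fin n ⊎ (Fin n × Fin 2 × Bool)} → AttAdj x y → AttAdj y x
  attSym (root-mid v i) = mid-root v i
  attSym (mid-root v i) = root-mid v i
  attSym (mid-end v i) = end-mid v i
  attSym (end-mid v i) = mid-end v i

  adjSym : ∀ {n} (F : FinGraph n) {x y} → AdjG F x y → AdjG F y x
  adjSym F {inj₁ u} {inj₁ w} a = FinGraph.sym F a
  adjSym F {inj₁ u} {inj₂ y} a = attSym a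
  adjSym F {inj₂ x} {inj₁ w} a = attSym a
  adjSym F {inj₂ x} {inj₂ y} a = attSym a

  adjIrr : ∀ {n} (F : FinGraph n) {x} → ¬ AdjG F x x
  adjIrr F {inj₁ u} a = FinGraph.irrefl F a
  adjIrr F {inj₂ _} ()

attach : ∀ {n} → FinGraph n → Graph
attach {n} F = record
  { V = Fin n ⊎ (Fin n × Fin 2 × Bool) ; Adj = AdjG F ; sym = λ {x} {y} → adjSym F {x} {y} ; irrefl = λ {x} → adjIrr F {x} }

-- Every vertex of G = attach F is a root (a vertex of F), the middle vertex of an attached path,
-- or its end. A matching covers at most n roots, 2n middles and 2n ends, so 2ν(G) ≤ 5n, and a
-- perfect matching of F together with all 2n pendant edges attains this. For edge-disjoint
-- matchings H, H′ roots and middles are covered at most twice, while an end is a leaf, so its only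
-- edge lies in at most one of H, H′: hence 2(|H| + |H′|) ≤ 6n + (middles covered by H′) ≤ 8n.
-- If |H| + |H′| = 4n, H′ must cover all 2n middles; no edge joins two middles, so |H′| ≥ 2n and
-- |H| ≤ 2n. Matching every root into its first path plus the pendant edge of its second path, and
-- the same with the two paths exchanged, attains both bounds.

module Submission where

open import Data.Bool using (Bool; true; false)
open import Data.Empty using (⊥)
open import Data.Fin using (Fin; zero; suc; _↑ˡ_; _↑ʳ_; splitAt)
open import Data.Fin.Properties using (splitAt-↑ˡ; splitAt-↑ʳ; splitAt⁻¹-↑ˡ; splitAt⁻¹-↑ʳ)
open import Data.List using (List; []; _∷_; _++_; length; map; concatMap; mapMaybe; allFin)
open import Data.List.Properties using (length-++; length-map; length-tabulate; concatMap-++; length-removeAt′)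
open import Data.List.Membership.Propositional using (_∈_; _∉_; find)
open import Data.List.Membership.Propositional.Properties using (∈-allFin; ∈-concatMap⁺; ∈-concatMap⁻; ∈-map⁻)
open import Data.List.Relation.Binary.Disjoint.Propositional using (Disjoint)
open import Data.List.Relation.Binary.Subset.Propositional using (_⊆_)
open import Data.List.Relation.Unary.All as All using (All; []; _∷_)
import Data.List.Relation.Unary.All.Properties as All
open import Data.List.Relation.Unary.Any as Any using (here; there; _─_)
open import Data.List.Relation.Unary.AllPairs using ([]; _∷_)
open import Data.List.Relation.Unary.Unique.Propositional using (Unique)
import Data.List.Relation.Unary.Unique.Propositional.Properties as Unique
open import Data.Maybe using (Maybe; just; nothing)
open import Data.Nat using (ℕ; zero; suc; _+_; _*_; _≤_; _⊔_; z≤n; s≤s)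
open import Data.Nat.Properties
open import Data.Nat.Tactic.RingSolver using (solve-∀)
open import Data.Product using (_×_; _,_; Σ; ∃-syntax; proj₁; proj₂)
open import Data.Sum as Sum using (_⊎_; inj₁; inj₂; [_,_]′)
open import Function using (id; _∘_)
open import Relation.Nullary using (contradiction)
open import Relation.Binary.PropositionalEquality
  using (_≡_; _≢_; refl; sym; trans; cong; cong₂; subst; module ≡-Reasoning)

open import Defs hiding (sym)

private variable
  A B : Set
  x y : A
  xs ys : List A

∈-─ : (x∈ys : x ∈ ys) → y ∈ ys → y ≢ x → y ∈ (ys ─ x∈ys)
∈-─ (here refl) (here refl) y≢x = contradiction refl y≢x
∈-─ (here refl) (there y∈ys) _ = y∈ys
∈-─ (there _) (here refl) _ = here refl
∈-─ (there x∈ys) (there y∈ys) y≢x = there (∈-─ x∈ys y∈ys y≢x)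

Unique∧⊆⇒length≤ : Unique xs → xs ⊆ ys → length xs ≤ length ys
Unique∧⊆⇒length≤ {xs = []} [] _ = z≤n
Unique∧⊆⇒length≤ {xs = x ∷ xs} {ys} (x∉xs ∷ u) xs⊆ys = begin
  suc (length xs)        ≤⟨ s≤s (Unique∧⊆⇒length≤ u xs⊆ys─x) ⟩
  suc (length (ys ─ x∈ys)) ≡⟨ length-removeAt′ ys _ ⟨
  length ys              ∎
  where
  open ≤-Reasoning
  x∈ys : x ∈ ys
  x∈ys = xs⊆ys (here refl)
  xs⊆ys─x : xs ⊆ (ys ─ x∈ys)
  xs⊆ys─x y∈xs = ∈-─ x∈ys (xs⊆ys (there y∈xs)) (λ y≡x → All.lookup x∉xs y∈xs (sym y≡x))

length-concatMap-const : (f : A → List B) {k : ℕ} → (∀ x → length (f x) ≡ k) →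
                         ∀ xs → length (concatMap f xs) ≡ k * length xs
length-concatMap-const f {k} _ [] = sym (*-zeroʳ k)
length-concatMap-const f {k} len-f (x ∷ xs) = begin
  length (f x ++ concatMap f xs)          ≡⟨ length-++ (f x) ⟩
  length (f x) + length (concatMap f xs)  ≡⟨ cong₂ _+_ (len-f x) (length-concatMap-const f len-f xs) ⟩
  k + k * length xs                       ≡⟨ *-suc k (length xs) ⟨
  k * suc (length xs)                     ∎
  where open ≡-Reasoning

∈-concatMap⁺′ : {f : A → List B} {x : A} {b : B} → x ∈ xs → b ∈ f x → b ∈ concatMap f xs
∈-concatMap⁺′ {f = f} x∈xs b∈fx = ∈-concatMap⁺ f (Any.map (λ { refl → b∈fx }) x∈xs)

Unique-concatMap⁺ : {f : A → List B} (key : B → A) → (∀ {x b} → b ∈ f x → key b ≡ x) →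
                    (∀ x → Unique (f x)) → Unique xs → Unique (concatMap f xs)
Unique-concatMap⁺ key key-f unique-f [] = []
Unique-concatMap⁺ {xs = x ∷ xs} {f = f} key key-f unique-f (x∉xs ∷ u) =
  Unique.++⁺ (unique-f x) (Unique-concatMap⁺ key key-f unique-f u) disjoint
  where
  disjoint : Disjoint (f x) (concatMap f xs)
  disjoint (b∈fx , b∈rest) with y , y∈xs , b∈fy ← find (∈-concatMap⁻ f b∈rest) =
    All.lookup x∉xs y∈xs (trans (sym (key-f b∈fx)) (key-f b∈fy))

module _ (f : A → Maybe B) (g : B → A) (f-just : ∀ {x b} → f x ≡ just b → x ≡ g b) where

  ∈-mapMaybe⇒∈ : ∀ {b} → b ∈ mapMaybe f xs → g b ∈ xs
  ∈-mapMaybe⇒∈ {xs = x ∷ xs} b∈ with f x in eq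
  ... | nothing = there (∈-mapMaybe⇒∈ b∈)
  ... | just c with b∈
  ...   | here refl = here (sym (f-just eq))
  ...   | there b∈′ = there (∈-mapMaybe⇒∈ b∈′)

  Unique-mapMaybe⁺ : Unique xs → Unique (mapMaybe f xs)
  Unique-mapMaybe⁺ [] = []
  Unique-mapMaybe⁺ {xs = x ∷ xs} (x∉xs ∷ u) with f x in eq
  ... | nothing = Unique-mapMaybe⁺ u
  ... | just b = All.tabulate (λ c∈ b≡c → All.lookup x∉xs (∈-mapMaybe⇒∈ c∈) (trans (f-just eq) (cong g b≡c)))
               ∷ Unique-mapMaybe⁺ u

length-allFin : ∀ n → length (allFin n) ≡ n
length-allFin n = length-tabulate id

Unique-Fin⇒length≤ : ∀ {n} {us : List (Fin n)} → Unique us → length us ≤ n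
Unique-Fin⇒length≤ {n} {us} u =
  subst (length us ≤_) (length-allFin n) (Unique∧⊆⇒length≤ u (λ {v} _ → ∈-allFin v))

module _ (G : Graph) where

  private variable
    H H' : List (V G × V G)

  Edges : List (V G × V G) → Set
  Edges = All (λ { (u , v) → Adj G u v })

  length-endpoints : ∀ M → length (endpoints G M) ≡ 2 * length M
  length-endpoints = length-concatMap-const _ (λ _ → refl)

  endpoints-++ : ∀ H H' → endpoints G (H ++ H') ≡ endpoints G H ++ endpoints G H'
  endpoints-++ = concatMap-++ _

  endpoints-concatMap : (f : A → List (V G × V G)) →
                        ∀ xs → endpoints G (concatMap f xs) ≡ concatMap (endpoints G ∘ f) xs
  endpoints-concatMap f [] = refl
  endpoints-concatMap f (x ∷ xs) =
    trans (endpoints-++ (f x) _) (cong (endpoints G (f x) ++_) (endpoints-concatMap f xs))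

  IsMatching-++ : IsMatching G H → IsMatching G H' → Disjoint (endpoints G H) (endpoints G H') →
                  IsMatching G (H ++ H')
  IsMatching-++ {H} {H'} (edges , u) (edges' , u') disjoint =
    All.++⁺ edges edges' , subst Unique (sym (endpoints-++ H H')) (Unique.++⁺ u u' disjoint)

  IsMatching-concatMap : {f : A → List (V G × V G)} (key : V G → A) →
                         (∀ {x b} → b ∈ endpoints G (f x) → key b ≡ x) →
                         (∀ x → IsMatching G (f x)) → Unique xs → IsMatching G (concatMap f xs)
  IsMatching-concatMap {xs = xs} {f} key key-f matching-f u =
    All.concat⁺ (All.map⁺ (All.universal (proj₁ ∘ matching-f) xs)) ,
    subst Unique (sym (endpoints-concatMap f xs)) (Unique-concatMap⁺ key key-f (proj₂ ∘ matching-f) u)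

  InB2-swap : InB2 G H H' → InB2 G H' H
  InB2-swap (m , m' , disjoint) = m' , m , λ e'∈ e∈ same → disjoint e∈ e'∈ (swap same)
    where
    swap : ∀ {e e'} → SameEdge G e e' → SameEdge G e' e
    swap (inj₁ (refl , refl)) = inj₁ (refl , refl)
    swap (inj₂ (refl , refl)) = inj₂ (refl , refl)

  module _ {t s : V G} (only-neighbour : ∀ {x} → Adj G t x → x ≡ s) where

    edge-at-leaf : Edges H → t ∈ endpoints G H → (t , s) ∈ H ⊎ (s , t) ∈ H
    edge-at-leaf (a ∷ _) (here refl) with refl ← only-neighbour a = inj₁ (here refl)
    edge-at-leaf (a ∷ _) (there (here refl)) with refl ← only-neighbour (Graph.sym G a) = inj₂ (here refl)
    edge-at-leaf (_ ∷ as) (there (there t∈)) = Sum.map there there (edge-at-leaf as t∈)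

    leaf-unshared : InB2 G H H' → t ∈ endpoints G H → t ∉ endpoints G H'
    leaf-unshared {H} {H'} ((edges , _) , (edges' , _) , disjoint) t∈ t∈' =
      same (edge-at-leaf edges t∈) (edge-at-leaf edges' t∈')
      where
      same : (t , s) ∈ H ⊎ (s , t) ∈ H → (t , s) ∈ H' ⊎ (s , t) ∈ H' → ⊥
      same (inj₁ e∈) (inj₁ e∈') = disjoint e∈ e∈' (inj₁ (refl , refl))
      same (inj₁ e∈) (inj₂ e∈') = disjoint e∈ e∈' (inj₂ (refl , refl))
      same (inj₂ e∈) (inj₁ e∈') = disjoint e∈ e∈' (inj₂ (refl , refl))
      same (inj₂ e∈) (inj₂ e∈') = disjoint e∈ e∈' (inj₁ (refl , refl))

  IsNu-unique : ∀ {a b} → IsNu G a → IsNu G b → a ≡ b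
  IsNu-unique ((M , m , refl) , ≤a) ((M' , m' , refl) , ≤b) = ≤-antisym (≤b M m) (≤a M' m')

  IsLambda2-unique : ∀ {l l'} → IsLambda2 G l → IsLambda2 G l' → l ≡ l'
  IsLambda2-unique ((H₁ , H₁' , b₁ , refl) , ≤l) ((H₂ , H₂' , b₂ , refl) , ≤l') =
    ≤-antisym (≤l' H₁ H₁' b₁) (≤l H₂ H₂' b₂)

  IsAlpha2-unique : ∀ {a a'} → IsAlpha2 G a → IsAlpha2 G a' → a ≡ a'
  IsAlpha2-unique (l , λ₂ , (H₁ , H₁' , b₁ , s₁ , refl) , ≤a) (l' , λ₂' , (H₂ , H₂' , b₂ , s₂ , refl) , ≤a')
    with refl ← IsLambda2-unique λ₂ λ₂' = ≤-antisym (≤a' H₁ H₁' b₁ s₁) (≤a H₂ H₂' b₂ s₂)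

perfectMatching-size : ∀ {n} (F : FinGraph n) {M} → IsPerfectMatching (toGraph F) M → 2 * length M ≡ n
perfectMatching-size {n} F {M} ((_ , u) , covers) = begin
  2 * length M                       ≡⟨ length-endpoints (toGraph F) M ⟨
  length (endpoints (toGraph F) M)   ≡⟨ ≤-antisym (Unique-Fin⇒length≤ u) n≤ ⟩
  n                                  ∎
  where
  open ≡-Reasoning
  n≤ : n ≤ length (endpoints (toGraph F) M)
  n≤ = subst (_≤ length (endpoints (toGraph F) M)) (length-allFin n)
             (Unique∧⊆⇒length≤ (Unique.allFin⁺ n) (λ {v} _ → covers v))

6n+2n≡2*4n : ∀ n → 6 * n + 2 * n ≡ 2 * (4 * n)
6n+2n≡2*4n = solve-∀

Vertex : ℕ → Set
Vertex n = Fin n ⊎ (Fin n × Fin 2 × Bool)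

Path : ℕ → Set
Path n = Fin n × Fin 2

module _ {n : ℕ} where

  root : Fin n → Vertex n
  root = inj₁

  mid end : Path n → Vertex n
  mid p = inj₂ (proj₁ p , proj₂ p , false)
  end p = inj₂ (proj₁ p , proj₂ p , true)

  base : Vertex n → Fin n
  base (inj₁ v) = v
  base (inj₂ (v , _)) = v

  root? : Vertex n → Maybe (Fin n)
  root? (inj₁ v) = just v
  root? (inj₂ _) = nothing

  mid? end? : Vertex n → Maybe (Path n)
  mid? (inj₂ (v , i , false)) = just (v , i)
  mid? _ = nothing
  end? (inj₂ (v , i , true)) = just (v , i)
  end? _ = nothing

  root?-just : ∀ {x v} → root? x ≡ just v → x ≡ root v
  root?-just {inj₁ _} refl = refl

  mid?-just : ∀ {x p} → mid? x ≡ just p → x ≡ mid p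
  mid?-just {inj₂ (_ , _ , false)} refl = refl

  end?-just : ∀ {x p} → end? x ≡ just p → x ≡ end p
  end?-just {inj₂ (_ , _ , true)} refl = refl

  roots : List (Vertex n) → List (Fin n)
  roots = mapMaybe root?

  mids ends : List (Vertex n) → List (Path n)
  mids = mapMaybe mid?
  ends = mapMaybe end?

  length-roots+mids+ends : ∀ xs → length xs ≡ length (roots xs) + length (mids xs) + length (ends xs)
  length-roots+mids+ends [] = refl
  length-roots+mids+ends (inj₁ _ ∷ xs) = cong suc (length-roots+mids+ends xs)
  length-roots+mids+ends (inj₂ (_ , _ , false) ∷ xs) = begin
    suc (length xs)                  ≡⟨ cong suc (length-roots+mids+ends xs) ⟩
    suc (r + m + e)                  ≡⟨ cong (_+ e) (+-suc r m) ⟨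
    r + suc m + e                    ∎
    where
    open ≡-Reasoning
    r m e : ℕ
    r = length (roots xs); m = length (mids xs); e = length (ends xs)
  length-roots+mids+ends (inj₂ (_ , _ , true) ∷ xs) = begin
    suc (length xs)                  ≡⟨ cong suc (length-roots+mids+ends xs) ⟩
    suc (r + m + e)                  ≡⟨ +-suc (r + m) e ⟨
    r + m + suc e                    ∎
    where
    open ≡-Reasoning
    r m e : ℕ
    r = length (roots xs); m = length (mids xs); e = length (ends xs)

  pathsAt : Fin n → List (Path n)
  pathsAt v = (v , zero) ∷ (v , suc zero) ∷ []

  allPaths : List (Path n)
  allPaths = concatMap pathsAt (allFin n)

  ∈-allPaths : ∀ p → p ∈ allPaths
  ∈-allPaths (v , i) = ∈-concatMap⁺′ (∈-allFin v) (∈-pathsAt i)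
    where
    ∈-pathsAt : ∀ i → (v , i) ∈ pathsAt v
    ∈-pathsAt zero = here refl
    ∈-pathsAt (suc zero) = there (here refl)

  Unique-Path⇒length≤ : {ps : List (Path n)} → Unique ps → length ps ≤ 2 * n
  Unique-Path⇒length≤ {ps} u = begin
    length ps          ≤⟨ Unique∧⊆⇒length≤ u (λ {p} _ → ∈-allPaths p) ⟩
    length allPaths    ≡⟨ length-concatMap-const pathsAt (λ _ → refl) (allFin n) ⟩
    2 * length (allFin n) ≡⟨ cong (2 *_) (length-allFin n) ⟩
    2 * n              ∎
    where open ≤-Reasoning

module _ {n : ℕ} (F : FinGraph n) where

  private
    G : Graph
    G = attach F
    variable
      H H' : List (Vertex n × Vertex n)

  endpoint-count : ∀ H → 2 * length H ≡
    length (roots (endpoints G H)) + length (mids (endpoints G H)) + length (ends (endpoints G H))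
  endpoint-count H = trans (sym (length-endpoints G H)) (length-roots+mids+ends (endpoints G H))

  roots-bound : IsMatching G H → length (roots (endpoints G H)) ≤ n
  roots-bound (_ , u) = Unique-Fin⇒length≤ (Unique-mapMaybe⁺ root? root root?-just u)

  mids-bound : IsMatching G H → length (mids (endpoints G H)) ≤ 2 * n
  mids-bound (_ , u) = Unique-Path⇒length≤ (Unique-mapMaybe⁺ mid? mid mid?-just u)

  ends-bound : IsMatching G H → length (ends (endpoints G H)) ≤ 2 * n
  ends-bound (_ , u) = Unique-Path⇒length≤ (Unique-mapMaybe⁺ end? end end?-just u)

  mids≤edges : Edges G H → length (mids (endpoints G H)) ≤ length H
  mids≤edges [] = z≤n
  mids≤edges {(inj₁ _ , inj₁ _) ∷ _} (_ ∷ as) = m≤n⇒m≤1+n (mids≤edges as)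
  mids≤edges {(inj₁ _ , inj₂ _) ∷ _} (root-mid _ _ ∷ as) = s≤s (mids≤edges as)
  mids≤edges {(inj₂ _ , inj₁ _) ∷ _} (mid-root _ _ ∷ as) = s≤s (mids≤edges as)
  mids≤edges {(inj₂ _ , inj₂ _) ∷ _} (mid-end _ _ ∷ as) = s≤s (mids≤edges as)
  mids≤edges {(inj₂ _ , inj₂ _) ∷ _} (end-mid _ _ ∷ as) = s≤s (mids≤edges as)

  end-only-neighbour : ∀ p {x} → Adj G (end p) x → x ≡ mid p
  end-only-neighbour _ (end-mid _ _) = refl

  ends-disjoint-bound : InB2 G H H' → length (ends (endpoints G H)) + length (ends (endpoints G H')) ≤ 2 * n
  ends-disjoint-bound {H} {H'} b@((_ , u) , (_ , u') , _) = subst (_≤ 2 * n) (length-++ (ends (endpoints G H)))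
    (Unique-Path⇒length≤ (Unique.++⁺ (Unique-mapMaybe⁺ end? end end?-just u)
                                     (Unique-mapMaybe⁺ end? end end?-just u') disjoint))
    where
    disjoint : Disjoint (ends (endpoints G H)) (ends (endpoints G H'))
    disjoint {p} (p∈ , p∈') = leaf-unshared G (end-only-neighbour p) b
      (∈-mapMaybe⇒∈ end? end end?-just p∈) (∈-mapMaybe⇒∈ end? end end?-just p∈')

  IsMatching-bound : ∀ {M} → IsMatching G M → 2 * length M ≤ 5 * n
  IsMatching-bound {M} m = begin
    2 * length M                                          ≡⟨ endpoint-count M ⟩
    length (roots E) + length (mids E) + length (ends E)  ≤⟨ +-mono-≤ (+-mono-≤ (roots-bound m) (mids-bound m)) (ends-bound m) ⟩
    n + 2 * n + 2 * n                                     ≡⟨ n+2n+2n≡5n n ⟩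
    5 * n                                                 ∎
    where
    open ≤-Reasoning
    E : List (Vertex n)
    E = endpoints G M
    n+2n+2n≡5n : ∀ n → n + 2 * n + 2 * n ≡ 5 * n
    n+2n+2n≡5n = solve-∀

  InB2-bound : InB2 G H H' → 2 * (length H + length H') ≤ 6 * n + length (mids (endpoints G H'))
  InB2-bound {H} {H'} b@(m , m' , _) = begin
    2 * (length H + length H')    ≡⟨ *-distribˡ-+ 2 (length H) (length H') ⟩
    2 * length H + 2 * length H'  ≡⟨ cong₂ _+_ (endpoint-count H) (endpoint-count H') ⟩
    (r + k + e) + (r' + k' + e')  ≡⟨ regroup r k e r' k' e' ⟩
    (r + k + r') + (e + e') + k'  ≤⟨ +-monoˡ-≤ k' (+-mono-≤ (+-mono-≤ (+-mono-≤ (roots-bound m) (mids-bound m))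
                                                                        (roots-bound m'))
                                                              (ends-disjoint-bound b)) ⟩
    (n + 2 * n + n) + 2 * n + k'  ≡⟨ cong (_+ k') (n+2n+n+2n≡6n n) ⟩
    6 * n + k'                    ∎
    where
    open ≤-Reasoning
    r k e r' k' e' : ℕ
    r = length (roots (endpoints G H)); k = length (mids (endpoints G H)); e = length (ends (endpoints G H))
    r' = length (roots (endpoints G H')); k' = length (mids (endpoints G H')); e' = length (ends (endpoints G H'))
    regroup : ∀ a b c a' b' c' → (a + b + c) + (a' + b' + c') ≡ (a + b + a') + (c + c') + b'
    regroup = solve-∀
    n+2n+n+2n≡6n : ∀ n → n + 2 * n + n + 2 * n ≡ 6 * n
    n+2n+n+2n≡6n = solve-∀

  lambda-bound : InB2 G H H' → length H + length H' ≤ 4 * n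
  lambda-bound {H} {H'} b@(_ , m' , _) = *-cancelˡ-≤ 2 (begin
    2 * (length H + length H')                ≤⟨ InB2-bound b ⟩
    6 * n + length (mids (endpoints G H'))    ≤⟨ +-monoʳ-≤ (6 * n) (mids-bound m') ⟩
    6 * n + 2 * n                             ≡⟨ 6n+2n≡2*4n n ⟩
    2 * (4 * n)                               ∎)
    where open ≤-Reasoning

  alpha-bound : InB2 G H H' → length H + length H' ≡ 4 * n → length H ≤ 2 * n
  alpha-bound {H} {H'} b@(_ , (edges' , _) , _) h+h'≡4n = +-cancelʳ-≤ (2 * n) (length H) (2 * n) (begin
    length H + 2 * n      ≤⟨ +-monoʳ-≤ (length H) 2n≤h' ⟩
    length H + length H'  ≡⟨ h+h'≡4n ⟩
    4 * n                 ≡⟨ 4n≡2n+2n n ⟩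
    2 * n + 2 * n         ∎)
    where
    open ≤-Reasoning
    4n≡2n+2n : ∀ n → 4 * n ≡ 2 * n + 2 * n
    4n≡2n+2n = solve-∀
    2n≤h' : 2 * n ≤ length H'
    2n≤h' = +-cancelˡ-≤ (6 * n) (2 * n) (length H') (begin
      6 * n + 2 * n                           ≡⟨ 6n+2n≡2*4n n ⟩
      2 * (4 * n)                             ≡⟨ cong (2 *_) h+h'≡4n ⟨
      2 * (length H + length H')              ≤⟨ InB2-bound b ⟩
      6 * n + length (mids (endpoints G H'))  ≤⟨ +-monoʳ-≤ (6 * n) (mids≤edges edges') ⟩
      6 * n + length H'                       ∎)

  crossing : Fin 2 → Fin 2 → Fin n → List (Vertex n × Vertex n)
  crossing i j v = (root v , mid (v , i)) ∷ (mid (v , j) , end (v , j)) ∷ []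

  crossings : Fin 2 → Fin 2 → List (Vertex n × Vertex n)
  crossings i j = concatMap (crossing i j) (allFin n)

  length-crossings : ∀ i j → length (crossings i j) ≡ 2 * n
  length-crossings i j = trans (length-concatMap-const (crossing i j) (λ _ → refl) (allFin n))
                               (cong (2 *_) (length-allFin n))

  crossings-matching : ∀ {i j} → i ≢ j → IsMatching G (crossings i j)
  crossings-matching {i} {j} i≢j = IsMatching-concatMap G base base-crossing crossing-matching (Unique.allFin⁺ n)
    where
    base-crossing : ∀ {v x} → x ∈ endpoints G (crossing i j v) → base x ≡ v
    base-crossing (here refl) = refl
    base-crossing (there (here refl)) = refl
    base-crossing (there (there (here refl))) = refl
    base-crossing (there (there (there (here refl)))) = refl
    crossing-matching : ∀ v → IsMatching G (crossing i j v)
    crossing-matching v = (root-mid v i ∷ mid-end v j ∷ []) ,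
      ((λ ()) ∷ (λ ()) ∷ (λ ()) ∷ []) ∷ ((λ { refl → i≢j refl }) ∷ (λ ()) ∷ []) ∷ ((λ ()) ∷ []) ∷ [] ∷ []

  ∈-crossings⁻ : ∀ {i j e} → e ∈ crossings i j →
                 ∃[ v ] (e ≡ (root v , mid (v , i)) ⊎ e ≡ (mid (v , j) , end (v , j)))
  ∈-crossings⁻ {i} {j} e∈ with v , _ , e∈crossing ← find (∈-concatMap⁻ (crossing i j) {xs = allFin n} e∈)
                          with e∈crossing
  ... | here e≡ = v , inj₁ e≡
  ... | there (here e≡) = v , inj₂ e≡

  crossings-disjoint : ∀ {i j} → i ≢ j → EdgeDisjoint G (crossings i j) (crossings j i)
  crossings-disjoint {i} {j} i≢j e∈ e'∈ with ∈-crossings⁻ e∈ | ∈-crossings⁻ e'∈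
  ... | _ , inj₁ refl | _ , inj₁ refl = λ { (inj₁ (_ , refl)) → i≢j refl ; (inj₂ (() , _)) }
  ... | _ , inj₁ refl | _ , inj₂ refl = λ { (inj₁ (() , _)) ; (inj₂ (() , _)) }
  ... | _ , inj₂ refl | _ , inj₁ refl = λ { (inj₁ (() , _)) ; (inj₂ (_ , ())) }
  ... | _ , inj₂ refl | _ , inj₂ refl = λ { (inj₁ (refl , _)) → i≢j refl ; (inj₂ (() , _)) }

  crossings-InB2 : InB2 G (crossings zero (suc zero)) (crossings (suc zero) zero)
  crossings-InB2 = crossings-matching (λ ()) , crossings-matching (λ ()) , crossings-disjoint (λ ())

  lift : Fin n × Fin n → Vertex n × Vertex n
  lift (u , w) = (root u , root w)

  pendantEdges : Fin n → List (Vertex n × Vertex n)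
  pendantEdges v = (mid (v , zero) , end (v , zero)) ∷ (mid (v , suc zero) , end (v , suc zero)) ∷ []

  allPendantEdges : List (Vertex n × Vertex n)
  allPendantEdges = concatMap pendantEdges (allFin n)

  endpoints-lift : ∀ M → endpoints G (map lift M) ≡ map root (endpoints (toGraph F) M)
  endpoints-lift [] = refl
  endpoints-lift ((u , w) ∷ M) = cong (λ xs → root u ∷ root w ∷ xs) (endpoints-lift M)

  lift-matching : ∀ {M} → IsMatching (toGraph F) M → IsMatching G (map lift M)
  lift-matching {M} (edges , u) =
    All.map⁺ edges , subst Unique (sym (endpoints-lift M)) (Unique.map⁺ (λ { refl → refl }) u)

  allPendantEdges-matching : IsMatching G allPendantEdges
  allPendantEdges-matching = IsMatching-concatMap G base base-pendantEdges pendantEdges-matching (Unique.allFin⁺ n)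
    where
    base-pendantEdges : ∀ {v x} → x ∈ endpoints G (pendantEdges v) → base x ≡ v
    base-pendantEdges (here refl) = refl
    base-pendantEdges (there (here refl)) = refl
    base-pendantEdges (there (there (here refl))) = refl
    base-pendantEdges (there (there (there (here refl)))) = refl
    pendantEdges-matching : ∀ v → IsMatching G (pendantEdges v)
    pendantEdges-matching v = (mid-end v zero ∷ mid-end v (suc zero) ∷ []) ,
      ((λ ()) ∷ (λ ()) ∷ (λ ()) ∷ []) ∷ ((λ ()) ∷ (λ ()) ∷ []) ∷ ((λ ()) ∷ []) ∷ [] ∷ []

  root∉allPendantEdges : ∀ u → root u ∉ endpoints G allPendantEdges
  root∉allPendantEdges u u∈
    with _ , _ , u∈pendantEdges ← find (∈-concatMap⁻ (endpoints G ∘ pendantEdges) {xs = allFin n}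
                                          (subst (root u ∈_) (endpoints-concatMap G pendantEdges (allFin n)) u∈))
    with u∈pendantEdges
  ... | here ()
  ... | there (here ())
  ... | there (there (here ()))
  ... | there (there (there (here ())))

  lift+pendants-matching : ∀ {M} → IsMatching (toGraph F) M → IsMatching G (map lift M ++ allPendantEdges)
  lift+pendants-matching {M} m = IsMatching-++ G (lift-matching m) allPendantEdges-matching disjoint
    where
    disjoint : Disjoint (endpoints G (map lift M)) (endpoints G allPendantEdges)
    disjoint (x∈ , x∈') with _ , _ , refl ← ∈-map⁻ root (subst (_ ∈_) (endpoints-lift M) x∈) =
      root∉allPendantEdges _ x∈'

  length-lift+pendants : ∀ M → length (map lift M ++ allPendantEdges) ≡ length M + 2 * n
  length-lift+pendants M = begin
    length (map lift M ++ allPendantEdges)         ≡⟨ length-++ (map lift M) ⟩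
    length (map lift M) + length allPendantEdges   ≡⟨ cong₂ _+_ (length-map lift M) length-allPendantEdges ⟩
    length M + 2 * n                               ∎
    where
    open ≡-Reasoning
    length-allPendantEdges : length allPendantEdges ≡ 2 * n
    length-allPendantEdges = trans (length-concatMap-const pendantEdges (λ _ → refl) (allFin n))
                                   (cong (2 *_) (length-allFin n))

  IsNu-attach : HasPerfectMatching (toGraph F) → ∃[ ν ] (IsNu G ν × 2 * ν ≡ 5 * n)
  IsNu-attach (M , perfect@(m , _)) =
    ν , ((map lift M ++ allPendantEdges , lift+pendants-matching m , length-lift+pendants M) , maximum) , 2ν≡5n
    where
    ν : ℕ
    ν = length M + 2 * n
    2ν≡5n : 2 * ν ≡ 5 * n
    2ν≡5n = begin
      2 * (length M + 2 * n)      ≡⟨ *-distribˡ-+ 2 (length M) (2 * n) ⟩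
      2 * length M + 2 * (2 * n)  ≡⟨ cong (_+ 2 * (2 * n)) (perfectMatching-size F perfect) ⟩
      n + 2 * (2 * n)             ≡⟨ n+2[2n]≡5n n ⟩
      5 * n                       ∎
      where
      open ≡-Reasoning
      n+2[2n]≡5n : ∀ n → n + 2 * (2 * n) ≡ 5 * n
      n+2[2n]≡5n = solve-∀
    maximum : ∀ M' → IsMatching G M' → length M' ≤ ν
    maximum M' m' = *-cancelˡ-≤ 2 (≤-trans (IsMatching-bound m') (≤-reflexive (sym 2ν≡5n)))

  length-crossings-pair : length (crossings zero (suc zero)) + length (crossings (suc zero) zero) ≡ 4 * n
  length-crossings-pair = trans (cong₂ _+_ (length-crossings _ _) (length-crossings _ _)) (2n+2n≡4n n)
    where
    2n+2n≡4n : ∀ n → 2 * n + 2 * n ≡ 4 * n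
    2n+2n≡4n = solve-∀

  IsLambda2-attach : IsLambda2 G (4 * n)
  IsLambda2-attach = (crossings zero (suc zero) , crossings (suc zero) zero , crossings-InB2 , length-crossings-pair) ,
                   λ _ _ → lambda-bound

  IsAlpha2-attach : IsAlpha2 G (2 * n)
  IsAlpha2-attach =
    4 * n , IsLambda2-attach ,
    (crossings zero (suc zero) , crossings (suc zero) zero , crossings-InB2 , length-crossings-pair ,
     trans (cong₂ _⊔_ (length-crossings _ _) (length-crossings _ _)) (⊔-idem (2 * n))) ,
    λ H H' b size → ⊔-lub (alpha-bound b size)
                          (alpha-bound (InB2-swap G b) (trans (+-comm (length H') (length H)) size))

  ratio-attach : HasPerfectMatching (toGraph F) → ∀ ν α → IsNu G ν → IsAlpha2 G α → 4 * ν ≡ 5 * α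
  ratio-attach perfect ν α isNu isAlpha with ν₀ , isNu₀ , 2ν₀≡5n ← IsNu-attach perfect = begin
    4 * ν         ≡⟨ cong (4 *_) (IsNu-unique G isNu isNu₀) ⟩
    4 * ν₀        ≡⟨ *-assoc 2 2 ν₀ ⟩
    2 * (2 * ν₀)  ≡⟨ cong (2 *_) 2ν₀≡5n ⟩
    2 * (5 * n)   ≡⟨ 2[5n]≡5[2n] n ⟩
    5 * (2 * n)   ≡⟨ cong (5 *_) (IsAlpha2-unique G IsAlpha2-attach isAlpha) ⟩
    5 * α         ∎
    where
    open ≡-Reasoning
    2[5n]≡5[2n] : ∀ n → 2 * (5 * n) ≡ 5 * (2 * n)
    2[5n]≡5[2n] = solve-∀

complete : ∀ k → FinGraph k
complete k = record { Adj = _≢_ ; sym = λ u≢v v≡u → u≢v (sym v≡u) ; irrefl = λ v≢v → v≢v refl }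

module _ (m : ℕ) where

  halves : Fin m → List (Fin (m + m) × Fin (m + m))
  halves i = (i ↑ˡ m , m ↑ʳ i) ∷ []

  halvesMatching : List (Fin (m + m) × Fin (m + m))
  halvesMatching = concatMap halves (allFin m)

  halvesMatching-perfect : IsPerfectMatching (toGraph (complete (m + m))) halvesMatching
  halvesMatching-perfect = IsMatching-concatMap K index index-halves halves-matching (Unique.allFin⁺ m) , covers
    where
    K : Graph
    K = toGraph (complete (m + m))
    index : Fin (m + m) → Fin m
    index v = [ id , id ]′ (splitAt m v)
    index-halves : ∀ {i v} → v ∈ endpoints K (halves i) → index v ≡ i
    index-halves {i} (here refl) = cong [ id , id ]′ (splitAt-↑ˡ m i m)
    index-halves {i} (there (here refl)) = cong [ id , id ]′ (splitAt-↑ʳ m m i)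
    halves-matching : ∀ i → IsMatching K (halves i)
    halves-matching i = (left≢right ∷ []) , (left≢right ∷ []) ∷ [] ∷ []
      where
      left≢right : i ↑ˡ m ≢ m ↑ʳ i
      left≢right eq with () ← trans (sym (splitAt-↑ˡ m i m)) (trans (cong (splitAt m) eq) (splitAt-↑ʳ m m i))
    covers : ∀ v → v ∈ endpoints K halvesMatching
    covers v = subst (v ∈_) (sym (endpoints-concatMap K halves (allFin m))) (covers′ (splitAt m v) refl)
      where
      covers′ : ∀ s → splitAt m v ≡ s → v ∈ concatMap (endpoints K ∘ halves) (allFin m)
      covers′ (inj₁ i) eq = ∈-concatMap⁺′ (∈-allFin i) (here (sym (splitAt⁻¹-↑ˡ eq)))
      covers′ (inj₂ i) eq = ∈-concatMap⁺′ (∈-allFin i) (there (here (sym (splitAt⁻¹-↑ʳ eq))))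

ratio-attained : (m : ℕ) → ∃[ n ] (m ≤ n × Σ (FinGraph n) λ F →
                 ∃[ ν ] ∃[ α ] (IsNu (attach F) ν × IsAlpha2 (attach F) α × 4 * ν ≡ 5 * α))
ratio-attained m =
  m + m , m≤m+n m m , K , ν , 2 * (m + m) , isNu , IsAlpha2-attach K ,
  ratio-attach K perfect ν _ isNu (IsAlpha2-attach K)
  where
  K : FinGraph (m + m)
  K = complete (m + m)
  perfect : HasPerfectMatching (toGraph K)
  perfect = halvesMatching m , halvesMatching-perfect m
  ν : ℕ
  ν = proj₁ (IsNu-attach K perfect)
  isNu : IsNu (attach K) ν
  isNu = proj₁ (proj₂ (IsNu-attach K perfect))

mainTheorem2 : ((n : ℕ) (F : FinGraph n) → HasPerfectMatching (toGraph F) →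
      (∃[ ν ] (IsNu (attach F) ν × 2 * ν ≡ 5 * n))
      × IsLambda2 (attach F) (4 * n)
      × IsAlpha2 (attach F) (2 * n)
      × (∀ ν α → IsNu (attach F) ν → IsAlpha2 (attach F) α → 4 * ν ≡ 5 * α))
    × ((m : ℕ) → ∃[ n ] (m ≤ n × Σ (FinGraph n) λ F →
        ∃[ ν ] ∃[ α ] (IsNu (attach F) ν × IsAlpha2 (attach F) α × 4 * ν ≡ 5 * α)))
mainTheorem2 =
  (λ n F perfect → IsNu-attach F perfect , IsLambda2-attach F , IsAlpha2-attach F , ratio-attach F perfect) ,
  ratio-attained
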